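{- Let $a,b$ be different digits from $\{1,3,7,9\}$. For every $n$ with $7\le n\le 16$, the integer $B_n(a,b)$ is not an absolute prime.
   Context: An absolute prime is a positive integer which is prime and remains prime after an arbitrary permutation of the digits of its decimal representation. $A_n=(10^n-1)/9$ is the repunit with $n$ decimal digits equal to $1$, and $B_n(a,b)=a\cdot A_n+(b-a)$ is the $n$-digit number whose decimal representation consists of $n-1$ digits $a$ followed by a final digit $b$. -}

module Defs where

open import Data.Nat using (ℕ; _+_; _*_; _∸_; _^_; _/_)
open import Data.Nat.Primality using (Prime)
open import Data.List using (List; foldl)
open import Data.List.Relation.Binary.Permutation.Propositional using (_↭_)
open import Data.Digit using (toNatDigits)
open import Data.Product using (_×_)

-- decimal digits of n, most significant first (stdlib)
decDigits : ℕ → List ℕ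
decDigits n = toNatDigits 10 n

fromDecDigits : List ℕ → ℕ
fromDecDigits = foldl (λ acc d → 10 * acc + d) 0

AbsolutePrime : ℕ → Set
AbsolutePrime n = Prime n × (∀ (ds : List ℕ) → ds ↭ decDigits n → Prime (fromDecDigits ds))

A : ℕ → ℕ
A n = (10 ^ n ∸ 1) / 9

-- B_n(a,b) = a * A_n + (b - a), computed over ℕ as a * A_n + b - a (a * A_n ≥ a for n ≥ 1)
B : ℕ → ℕ → ℕ → ℕ
B n a b = a * A n + b ∸ a

{-# OPTIONS --safe #-}
module Submission where

-- Every rearrangement of the digits of an absolute prime is prime, so B_n(a,b) is refuted
-- by exhibiting one rearrangement with a proper divisor. For each of the 120 cases it
-- suffices to move the final digit b at most four places to the left; the resulting
-- certificates (shift, divisor) are checked by evaluation. For {a, b} = {3, 9} the digit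
-- sum is divisible by 3 for every n.

open import Defs
open import Data.Nat using (ℕ; zero; suc; _+_; _∸_; _≤_; _<_; _≤?_; _<?_; _≟_; s≤s; n>1⇒nonTrivial)
open import Data.Nat.Properties using (m∸n+n≡m; m+[n∸m]≡n; m+n∸m≡n; ∸-monoˡ-≤)
open import Data.Nat.Divisibility using (_∣_; _∣?_)
open import Data.Nat.Primality using (Composite; composite; Prime)
open import Data.List using (List; _∷_; []; [_]; _++_; replicate; applyUpTo)
open import Data.List.Properties using (≡-dec)
open import Data.List.Membership.Propositional using (_∈_)
open import Data.List.Membership.Propositional.Properties using (∈-applyUpTo⁺)
open import Data.List.Relation.Unary.All using (All; all?; lookup)
open import Data.List.Relation.Binary.Permutation.Propositional
  using (_↭_; module PermutationReasoning)
open import Data.List.Relation.Binary.Permutation.Propositional.Properties using (shift; ++-comm)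
open import Data.Product using (_×_; _,_)
open import Data.Sum using (_⊎_; [_,_]′)
open import Relation.Nullary using (¬_; Dec; contradiction)
open import Relation.Nullary.Decidable using (_×-dec_; _⊎-dec_; toWitness)
open import Relation.Binary.PropositionalEquality using (_≡_; _≢_; refl; sym; cong; subst)

↭-composite⇒¬AbsolutePrime : ∀ {m} ds → ds ↭ decDigits m → Composite (fromDecDigits ds) →
                              ¬ AbsolutePrime m
↭-composite⇒¬AbsolutePrime ds ds↭m c (_ , rearranged-prime) =
  Prime.notComposite (rearranged-prime ds ds↭m) c

replicate-++ : ∀ {A : Set} (a : A) k j → replicate k a ++ replicate j a ≡ replicate (k + j) a
replicate-++ a zero    j = refl
replicate-++ a (suc k) j = cong (a ∷_) (replicate-++ a k j)

replicate-insert-↭ : ∀ {A : Set} (a b : A) k j →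
                     replicate k a ++ b ∷ replicate j a ↭ replicate (k + j) a ++ [ b ]
replicate-insert-↭ a b k j = begin
  replicate k a ++ b ∷ replicate j a   ↭⟨ shift b (replicate k a) (replicate j a) ⟩
  b ∷ replicate k a ++ replicate j a   ≡⟨ cong (b ∷_) (replicate-++ a k j) ⟩
  [ b ] ++ replicate (k + j) a         ↭⟨ ++-comm [ b ] (replicate (k + j) a) ⟩
  replicate (k + j) a ++ [ b ]         ∎
  where open PermutationReasoning

ProperDivisor : ℕ → ℕ → Set
ProperDivisor d n = 1 < d × d < n × d ∣ n

properDivisor? : ∀ d n → Dec (ProperDivisor d n)
properDivisor? d n = (1 <? d) ×-dec (d <? n) ×-dec (d ∣? n)

properDivisor⇒composite : ∀ {d n} → ProperDivisor d n → Composite n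
properDivisor⇒composite (1<d , d<n , d∣n) = composite d<n d∣n
  where instance _ = n>1⇒nonTrivial 1<d

∈-applyUpTo-+ : ∀ {m n} k → m ≤ n → n ≤ m + k → n ∈ applyUpTo (m +_) (1 + k)
∈-applyUpTo-+ {m} {n} k m≤n n≤m+k =
  subst (_∈ applyUpTo (m +_) (1 + k)) (m+[n∸m]≡n m≤n)
    (∈-applyUpTo⁺ (m +_) (s≤s (subst (n ∸ m ≤_) (m+n∸m≡n m k) (∸-monoˡ-≤ m n≤m+k))))

shiftLast : ℕ → ℕ → ℕ → ℕ → List ℕ
shiftLast n a b j = replicate (n ∸ 1 ∸ j) a ++ b ∷ replicate j a

Refutes : ℕ → ℕ → ℕ → ℕ × ℕ → Set
Refutes n a b (j , d) =
  decDigits (B n a b) ≡ replicate (n ∸ 1) a ++ [ b ] ×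
  j ≤ n ∸ 1 ×
  ProperDivisor d (fromDecDigits (shiftLast n a b j))

refutes? : ∀ n a b c → Dec (Refutes n a b c)
refutes? n a b (j , d) =
  ≡-dec _≟_ (decDigits (B n a b)) (replicate (n ∸ 1) a ++ [ b ]) ×-dec
  j ≤? n ∸ 1 ×-dec
  properDivisor? d (fromDecDigits (shiftLast n a b j))

refutes⇒¬AbsolutePrime : ∀ {n a b} c → Refutes n a b c → ¬ AbsolutePrime (B n a b)
refutes⇒¬AbsolutePrime {n} {a} {b} (j , _) (digits , j≤n-1 , divisor) =
  ↭-composite⇒¬AbsolutePrime (shiftLast n a b j) shiftLast↭digits
    (properDivisor⇒composite divisor)
  where
  shiftLast↭digits : shiftLast n a b j ↭ decDigits (B n a b)
  shiftLast↭digits = begin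
    shiftLast n a b j                   ↭⟨ replicate-insert-↭ a b (n ∸ 1 ∸ j) j ⟩
    replicate (n ∸ 1 ∸ j + j) a ++ [ b ] ≡⟨ cong (λ k → replicate k a ++ [ b ]) (m∸n+n≡m j≤n-1) ⟩
    replicate (n ∸ 1) a ++ [ b ]         ≡⟨ sym digits ⟩
    decDigits (B n a b)                  ∎
    where open PermutationReasoning

-- Junk certificates outside the range of the theorem are never checked.
certificate : ℕ → ℕ → ℕ → ℕ × ℕ
certificate 1 3 = λ { 7 → 0 , 3 ; 8 → 0 , 13 ; 9 → 2 , 223 ; 10 → 0 , 3 ; 11 → 2 , 17
                    ; 12 → 0 , 461 ; 13 → 0 , 3 ; 14 → 0 , 13 ; 15 → 0 , 1163 ; 16 → 0 , 3 ; _ → 0 , 0 }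
certificate 1 7 = λ { 7 → 0 , 7 ; 8 → 2 , 13 ; 9 → 0 , 3 ; 10 → 0 , 23 ; 11 → 0 , 1021
                    ; 12 → 0 , 3 ; 13 → 0 , 7 ; 14 → 0 , 419 ; 15 → 0 , 3 ; 16 → 0 , 19 ; _ → 0 , 0 }
certificate 1 9 = λ { 7 → 0 , 3 ; 8 → 1 , 7 ; 9 → 0 , 7 ; 10 → 0 , 3 ; 11 → 0 , 43
                    ; 12 → 0 , 79 ; 13 → 0 , 3 ; 14 → 0 , 107 ; 15 → 0 , 7 ; 16 → 0 , 3 ; _ → 0 , 0 }
certificate 3 1 = λ { 7 → 4 , 41 ; 8 → 1 , 13 ; 9 → 0 , 17 ; 10 → 0 , 673 ; 11 → 0 , 307
                    ; 12 → 0 , 19 ; 13 → 0 , 523 ; 14 → 0 , 607 ; 15 → 0 , 181 ; 16 → 0 , 199 ; _ → 0 , 0 }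
certificate 3 7 = λ { 7 → 0 , 7 ; 8 → 0 , 37 ; 9 → 0 , 29 ; 10 → 0 , 191 ; 11 → 0 , 37
                    ; 12 → 0 , 269 ; 13 → 0 , 7 ; 14 → 0 , 23 ; 15 → 0 , 19 ; 16 → 0 , 59 ; _ → 0 , 0 }
certificate 3 9 = λ _ → 0 , 3
certificate 7 1 = λ { 7 → 0 , 29 ; 8 → 0 , 17 ; 9 → 0 , 3 ; 10 → 0 , 499 ; 11 → 0 , 151
                    ; 12 → 0 , 3 ; 13 → 1 , 19 ; 14 → 0 , 23 ; 15 → 0 , 3 ; 16 → 0 , 997 ; _ → 0 , 0 }
certificate 7 3 = λ { 7 → 0 , 3 ; 8 → 0 , 19 ; 9 → 1 , 11 ; 10 → 0 , 3 ; 11 → 0 , 29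
                    ; 12 → 1 , 23 ; 13 → 0 , 3 ; 14 → 0 , 2579 ; 15 → 1 , 11 ; 16 → 0 , 3 ; _ → 0 , 0 }
certificate 7 9 = λ { 7 → 0 , 3 ; 8 → 0 , 41 ; 9 → 0 , 3319 ; 10 → 0 , 3 ; 11 → 0 , 13
                    ; 12 → 0 , 17 ; 13 → 0 , 3 ; 14 → 0 , 5347 ; 15 → 0 , 23 ; 16 → 0 , 3 ; _ → 0 , 0 }
certificate 9 1 = λ { 7 → 1 , 173 ; 8 → 0 , 7 ; 9 → 0 , 67 ; 10 → 0 , 19 ; 11 → 0 , 83
                    ; 12 → 0 , 757 ; 13 → 0 , 31 ; 14 → 0 , 7 ; 15 → 0 , 653 ; 16 → 0 , 643 ; _ → 0 , 0 }
certificate 9 3 = λ _ → 0 , 3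
certificate 9 7 = λ { 7 → 0 , 7 ; 8 → 0 , 1297 ; 9 → 0 , 71 ; 10 → 0 , 13 ; 11 → 0 , 17
                    ; 12 → 0 , 5507 ; 13 → 0 , 7 ; 14 → 0 , 839 ; 15 → 0 , 599 ; 16 → 0 , 13 ; _ → 0 , 0 }
certificate _ _ = λ _ → 0 , 0

coprimeDigits : List ℕ
coprimeDigits = 1 ∷ 3 ∷ 7 ∷ 9 ∷ []

lengths : List ℕ
lengths = applyUpTo (7 +_) 10

CertifiedPair : ℕ → ℕ → Set
CertifiedPair a b = a ≡ b ⊎ All (λ n → Refutes n a b (certificate a b n)) lengths

certifiedPair? : ∀ a b → Dec (CertifiedPair a b)
certifiedPair? a b = (a ≟ b) ⊎-dec all? (λ n → refutes? n a b (certificate a b n)) lengths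

all-certified : All (λ a → All (CertifiedPair a) coprimeDigits) coprimeDigits
all-certified = toWitness {a? = all? (λ a → all? (certifiedPair? a) coprimeDigits) coprimeDigits} _

lemma7 : ∀ (a b n : ℕ) → a ∈ (1 ∷ 3 ∷ 7 ∷ 9 ∷ []) → b ∈ (1 ∷ 3 ∷ 7 ∷ 9 ∷ []) → a ≢ b →
    7 ≤ n → n ≤ 16 → ¬ AbsolutePrime (B n a b)
-- Eliminating with [_,_]′ rather than `with` keeps Agda from normalising the proof term all-certified.
lemma7 a b n a∈ b∈ a≢b 7≤n n≤16 =
  [ (λ a≡b → contradiction a≡b a≢b)
  , (λ refuted → refutes⇒¬AbsolutePrime {n} {a} {b} (certificate a b n)
                   (lookup refuted (∈-applyUpTo-+ 9 7≤n n≤16)))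
  ]′ (lookup (lookup all-certified a∈) b∈)
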